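{- Let $G$ be a nut graph. Then $G$ is not edge transitive, i.e. $\mathrm{Aut}(G)$ does not act transitively on $E(G)$ (equivalently $o_e(G) \neq 1$).
   Context: All graphs are finite, simple and connected. A nut graph is a graph $G$ whose adjacency matrix $\mathbf{A}(G)$ has one-dimensional kernel, spanned by a vector with no zero entry; the isolated vertex $K_1$ is by convention excluded as trivial. $\mathrm{Aut}(G)$ is the full automorphism group and $o_e(G)$ is the number of its orbits on edges. -}

module Defs where

open import Data.Nat using (ℕ; zero; suc; _≤_)
open import Data.Fin using (Fin; zero; suc)
open import Data.Bool using (Bool; true; false; if_then_else_)
open import Data.Rational using (ℚ; 0ℚ; _+_; _*_)
open import Data.Product using (Σ; _×_; _,_; ∃)
open import Data.Sum using (_⊎_)
open import Relation.Binary.PropositionalEquality using (_≡_)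
open import Relation.Nullary using (¬_)
open import Data.Fin.Permutation using (Permutation′; _⟨$⟩ʳ_)

record Graph (n : ℕ) : Set where
  field
    adj   : Fin n → Fin n → Bool
    sym   : ∀ i j → adj i j ≡ adj j i
    irrefl : ∀ i → adj i i ≡ false
open Graph public

data Reach {n : ℕ} (G : Graph n) (u : Fin n) : Fin n → Set where
  here : Reach G u u
  step : ∀ {v w} → Reach G u v → adj G v w ≡ true → Reach G u w

Connected : ∀ {n} → Graph n → Set
Connected {n} G = ∀ (u v : Fin n) → Reach G u v

ΣFin : ∀ n → (Fin n → ℚ) → ℚ
ΣFin zero f = 0ℚ
ΣFin (suc n) f = f zero + ΣFin n (λ i → f (suc i))

A : ∀ {n} → Graph n → Fin n → Fin n → ℚ
A G i j = if adj G i j then Data.Rational.1ℚ else 0ℚ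

mulA : ∀ {n} → Graph n → (Fin n → ℚ) → Fin n → ℚ
mulA {n} G x i = ΣFin n (λ j → A G i j * x j)

InKernel : ∀ {n} → Graph n → (Fin n → ℚ) → Set
InKernel G x = ∀ i → mulA G x i ≡ 0ℚ

KernelSpannedBy : ∀ {n} → Graph n → (Fin n → ℚ) → Set
KernelSpannedBy {n} G x =
  InKernel G x × (¬ (∀ i → x i ≡ 0ℚ)) ×
  (∀ y → InKernel G y → Σ ℚ λ c → ∀ i → y i ≡ c * x i)

-- Nut graph: connected, not K₁ (n ≥ 2), one-dimensional kernel spanned by a
-- vector with no zero entry.
IsNut : ∀ {n} → Graph n → Set
IsNut {n} G = 2 ≤ n × Connected G ×
  Σ (Fin n → ℚ) λ x → KernelSpannedBy G x × (∀ i → ¬ (x i ≡ 0ℚ))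

IsAut : ∀ {n} → Graph n → Permutation′ n → Set
IsAut {n} G σ = ∀ (i j : Fin n) → adj G (σ ⟨$⟩ʳ i) (σ ⟨$⟩ʳ j) ≡ adj G i j

MapsEdge : ∀ {n} → Permutation′ n → Fin n → Fin n → Fin n → Fin n → Set
MapsEdge σ u v x y =
  ((σ ⟨$⟩ʳ u) ≡ x × (σ ⟨$⟩ʳ v) ≡ y) ⊎ ((σ ⟨$⟩ʳ u) ≡ y × (σ ⟨$⟩ʳ v) ≡ x)

EdgeTransitive : ∀ {n} → Graph n → Set
EdgeTransitive {n} G = ∀ (u v x y : Fin n) → adj G u v ≡ true → adj G x y ≡ true →
  Σ (Permutation′ n) λ σ → IsAut G σ × MapsEdge σ u v x y

{-# OPTIONS --safe #-}
-- If x spans ker A(G) and σ ∈ Aut(G), then x ∘ σ is again in the kernel, hence x ∘ σ = c x.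
-- Applied to an automorphism carrying an edge uv onto an edge st this gives
-- x_s x_t = c² x_u x_v, so in an edge-transitive graph all the products x_s x_t over
-- edges st have the same weak sign. Fix an edge ab and put p = x_a x_b ≠ 0: the row a
-- of A(G) x = 0, multiplied by x_a p, is a sum of terms (x_a x_j) p ≥ 0 over the
-- neighbours j of a whose term j = b is p² > 0, a contradiction.
module Submission where

open import Defs hiding (sym)
open import Data.Nat using (ℕ; zero; suc; s≤s; z≤n)
open import Data.Fin using (Fin; zero; suc; punchIn)
open import Data.Fin.Permutation using (Permutation′; _⟨$⟩ʳ_)
open import Data.Bool using (true; false; if_then_else_)
open import Data.Rational
  using (ℚ; 0ℚ; 1ℚ; _+_; _*_; _≤_; _<_; positive; negative; nonNegative; nonPositive)
open import Data.Rational.Properties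
open import Data.Rational.Solver using (module +-*-Solver)
open import Data.Product using (∃; _,_)
open import Data.Sum using (inj₁; inj₂)
open import Relation.Nullary using (¬_; contradiction)
open import Relation.Binary.Definitions using (tri<; tri≈; tri>)
open import Relation.Binary.PropositionalEquality
  using (_≡_; _≢_; refl; sym; trans; cong; cong₂; subst; module ≡-Reasoning)
open import Algebra.Bundles using (CommutativeRing)
import Algebra.Properties.Semiring.Sum as SemiringSum

open +-*-Solver
open SemiringSum (CommutativeRing.semiring +-*-commutativeRing)
  using (sum; sum-permute; sum-remove; sum-cong-≗; *-distribʳ-sum)

square-nonNeg : ∀ p → 0ℚ ≤ p * p
square-nonNeg p with ≤-total 0ℚ p
... | inj₁ 0≤p = nonNegative⁻¹ _ {{nonNeg*nonNeg⇒nonNeg p {{nonNegative 0≤p}} p {{nonNegative 0≤p}}}}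
... | inj₂ p≤0 = nonNegative⁻¹ _ {{nonPos*nonPos⇒nonPos p {{nonPositive p≤0}} p {{nonPositive p≤0}}}}

square-pos : ∀ p → p ≢ 0ℚ → 0ℚ < p * p
square-pos p p≢0 with <-cmp p 0ℚ
... | tri< p<0 _ _ = positive⁻¹ _ {{neg*neg⇒pos p {{negative p<0}} p {{negative p<0}}}}
... | tri≈ _ p≡0 _ = contradiction p≡0 p≢0
... | tri> _ _ 0<p = positive⁻¹ _ {{pos*pos⇒pos p {{positive 0<p}} p {{positive 0<p}}}}

*-≢0 : ∀ {p q} → p ≢ 0ℚ → q ≢ 0ℚ → p * q ≢ 0ℚ
*-≢0 {p} {q} p≢0 q≢0 pq≡0 = <-irrefl (sym pq²≡0) 0<pq²
  where
  0<pq² : 0ℚ < (p * q) * (p * q)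
  0<pq² = subst (0ℚ <_)
    (solve 2 (λ p q → (p :* p) :* (q :* q) := (p :* q) :* (p :* q)) refl p q)
    (positive⁻¹ _ {{pos*pos⇒pos (p * p) {{positive (square-pos p p≢0)}}
                                (q * q) {{positive (square-pos q q≢0)}}}})
  pq²≡0 : (p * q) * (p * q) ≡ 0ℚ
  pq²≡0 = cong (λ r → r * r) pq≡0

sum-nonNeg : ∀ {n} (f : Fin n → ℚ) → (∀ i → 0ℚ ≤ f i) → 0ℚ ≤ sum f
sum-nonNeg {zero}  f f≥0 = ≤-refl
sum-nonNeg {suc n} f f≥0 = +-mono-≤ (f≥0 zero) (sum-nonNeg (λ i → f (suc i)) (λ i → f≥0 (suc i)))

sum-pos : ∀ {n} (f : Fin n → ℚ) → (∀ i → 0ℚ ≤ f i) → ∀ b → 0ℚ < f b → 0ℚ < sum f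
sum-pos {suc n} f f≥0 b 0<fb =
  subst (0ℚ <_) (sym (sum-remove {i = b} f))
    (+-mono-<-≤ 0<fb (sum-nonNeg _ (λ i → f≥0 (punchIn b i))))

ΣFin≡sum : ∀ n (f : Fin n → ℚ) → ΣFin n f ≡ sum f
ΣFin≡sum zero    f = refl
ΣFin≡sum (suc n) f = cong (f zero +_) (ΣFin≡sum n (λ i → f (suc i)))

mulA≡sum : ∀ {n} (G : Graph n) x i → mulA G x i ≡ sum (λ j → A G i j * x j)
mulA≡sum {n} G x i = ΣFin≡sum n _

A-adj : ∀ {n} (G : Graph n) {i j b} → adj G i j ≡ b → A G i j ≡ (if b then 1ℚ else 0ℚ)
A-adj G i∼j = cong (if_then 1ℚ else 0ℚ) i∼j

Connected⇒edge : ∀ {n} (G : Graph (suc (suc n))) → Connected G → ∃ λ u → ∃ λ v → adj G u v ≡ true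
Connected⇒edge G conn = lastEdge (conn zero (suc zero))
  where
  lastEdge : Reach G zero (suc zero) → ∃ λ u → ∃ λ v → adj G u v ≡ true
  lastEdge (step {v} {w} _ v∼w) = v , w , v∼w

InKernel-∘aut : ∀ {n} (G : Graph n) {x} (σ : Permutation′ n) → IsAut G σ →
  InKernel G x → InKernel G (λ i → x (σ ⟨$⟩ʳ i))
InKernel-∘aut G {x} σ aut Ax≡0 i = begin
  mulA G (λ j → x (σ ⟨$⟩ʳ j)) i                       ≡⟨ mulA≡sum G _ i ⟩
  sum (λ j → A G i j * x (σ ⟨$⟩ʳ j))                  ≡⟨ sum-cong-≗ (λ j → cong (_* x (σ ⟨$⟩ʳ j)) (sym (A-adj G (aut i j)))) ⟩
  sum (λ j → A G (σ ⟨$⟩ʳ i) (σ ⟨$⟩ʳ j) * x (σ ⟨$⟩ʳ j)) ≡⟨ sym (sum-permute (λ j → A G (σ ⟨$⟩ʳ i) j * x j) σ) ⟩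
  sum (λ j → A G (σ ⟨$⟩ʳ i) j * x j)                  ≡⟨ sym (mulA≡sum G x (σ ⟨$⟩ʳ i)) ⟩
  mulA G x (σ ⟨$⟩ʳ i)                                 ≡⟨ Ax≡0 (σ ⟨$⟩ʳ i) ⟩
  0ℚ                                                  ∎
  where open ≡-Reasoning

KernelSpannedBy⇒∘aut-multiple : ∀ {n} (G : Graph n) {x} → KernelSpannedBy G x →
  ∀ σ → IsAut G σ → ∃ λ c → ∀ i → x (σ ⟨$⟩ʳ i) ≡ c * x i
KernelSpannedBy⇒∘aut-multiple G (Ax≡0 , _ , spans) σ aut = spans _ (InKernel-∘aut G σ aut Ax≡0)

KernelSpannedBy⇒edgeProduct-scaled : ∀ {n} (G : Graph n) {x} → KernelSpannedBy G x →
  ∀ σ → IsAut G σ → ∀ {u v s t} → MapsEdge σ u v s t →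
  ∃ λ c → x s * x t ≡ (c * c) * (x u * x v)
KernelSpannedBy⇒edgeProduct-scaled G {x} spanned σ aut {u} {v} maps
  with KernelSpannedBy⇒∘aut-multiple G spanned σ aut
... | c , xσ≡cx = c , scaled maps
  where
  open ≡-Reasoning
  scaled : ∀ {s t} → MapsEdge σ u v s t → x s * x t ≡ (c * c) * (x u * x v)
  scaled (inj₁ (refl , refl)) = begin
    x (σ ⟨$⟩ʳ u) * x (σ ⟨$⟩ʳ v) ≡⟨ cong₂ _*_ (xσ≡cx u) (xσ≡cx v) ⟩
    (c * x u) * (c * x v)       ≡⟨ solve 3 (λ c p q → (c :* p) :* (c :* q) := (c :* c) :* (p :* q)) refl c (x u) (x v) ⟩
    (c * c) * (x u * x v)       ∎
  scaled (inj₂ (refl , refl)) = begin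
    x (σ ⟨$⟩ʳ v) * x (σ ⟨$⟩ʳ u) ≡⟨ cong₂ _*_ (xσ≡cx v) (xσ≡cx u) ⟩
    (c * x v) * (c * x u)       ≡⟨ solve 3 (λ c p q → (c :* q) :* (c :* p) := (c :* c) :* (p :* q)) refl c (x u) (x v) ⟩
    (c * c) * (x u * x v)       ∎

EdgeTransitive⇒edgeProducts-sameSign : ∀ {n} (G : Graph n) {x} → EdgeTransitive G →
  KernelSpannedBy G x → ∀ {u v s t} → adj G u v ≡ true → adj G s t ≡ true →
  0ℚ ≤ (x s * x t) * (x u * x v)
EdgeTransitive⇒edgeProducts-sameSign G {x} et spanned {u} {v} {s} {t} u∼v s∼t
  with et u v s t u∼v s∼t
... | σ , aut , maps with KernelSpannedBy⇒edgeProduct-scaled G spanned σ aut maps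
...   | c , xsxt≡c²xuxv = subst (0ℚ ≤_) (sym square) (square-nonNeg (c * p))
  where
  p = x u * x v
  square : (x s * x t) * p ≡ (c * p) * (c * p)
  square = trans (cong (_* p) xsxt≡c²xuxv)
    (solve 2 (λ c p → (c :* c :* p) :* p := (c :* p) :* (c :* p)) refl c p)

InKernel⇒¬neighbourhood-semipositive : ∀ {n} (G : Graph n) {x} → InKernel G x →
  ∀ {a b} w → adj G a b ≡ true → (∀ j → adj G a j ≡ true → 0ℚ ≤ x j * w) → ¬ (0ℚ < x b * w)
InKernel⇒¬neighbourhood-semipositive G {x} Ax≡0 {a} {b} w a∼b semipos 0<xbw =
  <-irrefl (sym weightedRow≡0) (sum-pos term term-nonNeg b (subst (0ℚ <_) (sym (term-adj a∼b)) 0<xbw))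
  where
  term : Fin _ → ℚ
  term j = (A G a j * x j) * w
  term-adj : ∀ {j} → adj G a j ≡ true → term j ≡ x j * w
  term-adj {j} a∼j = trans (cong (λ r → (r * x j) * w) (A-adj G a∼j)) (cong (_* w) (*-identityˡ (x j)))
  term-nonNeg : ∀ j → 0ℚ ≤ term j
  term-nonNeg j = byAdjacency (adj G a j) refl
    where
    byAdjacency : ∀ e → adj G a j ≡ e → 0ℚ ≤ term j
    byAdjacency true  a∼j = subst (0ℚ ≤_) (sym (term-adj a∼j)) (semipos j a∼j)
    byAdjacency false a≁j = subst (0ℚ ≤_) (sym term≡0) ≤-refl
      where
      term≡0 : term j ≡ 0ℚ
      term≡0 = trans (cong (λ r → (r * x j) * w) (A-adj G a≁j))
                     (trans (cong (_* w) (*-zeroˡ (x j))) (*-zeroˡ w))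
  weightedRow≡0 : sum term ≡ 0ℚ
  weightedRow≡0 = begin
    sum term                            ≡⟨ sym (*-distribʳ-sum w (λ j → A G a j * x j)) ⟩
    sum (λ j → A G a j * x j) * w       ≡⟨ cong (_* w) (trans (sym (mulA≡sum G x a)) (Ax≡0 a)) ⟩
    0ℚ * w                              ≡⟨ *-zeroˡ w ⟩
    0ℚ                                  ∎
    where open ≡-Reasoning

corollary2 : ∀ (n : ℕ) (G : Graph n) → IsNut G → ¬ EdgeTransitive G
corollary2 (suc (suc m)) G (s≤s (s≤s z≤n) , conn , x , spanned@(Ax≡0 , _) , x≢0) et
  with Connected⇒edge G conn
... | a , b , a∼b =
  InKernel⇒¬neighbourhood-semipositive G {x} Ax≡0 (x a * p) a∼b neighbour-nonNeg b-pos
  where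
  p = x a * x b
  neighbour-nonNeg : ∀ j → adj G a j ≡ true → 0ℚ ≤ x j * (x a * p)
  neighbour-nonNeg j a∼j = subst (0ℚ ≤_)
    (solve 3 (λ xa xj p → (xa :* xj) :* p := xj :* (xa :* p)) refl (x a) (x j) p)
    (EdgeTransitive⇒edgeProducts-sameSign G et spanned a∼b a∼j)
  b-pos : 0ℚ < x b * (x a * p)
  b-pos = subst (0ℚ <_)
    (solve 2 (λ xa xb → (xa :* xb) :* (xa :* xb) := xb :* (xa :* (xa :* xb))) refl (x a) (x b))
    (square-pos p (*-≢0 (x≢0 a) (x≢0 b)))
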